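{- Let $\mathbf{w}$ be an infinite binary word with factor complexity at most $2n$ (i.e., for every $n\ge1$, $\mathbf{w}$ has at most $2n$ distinct factors of length $n$) which avoids $(5/2)^+$-powers. Then, up to binary complement and/or reversal, the set of length-4 factors of $\mathbf{w}$ is exactly $\{0110,1001,0011,1100,0010,0100,1101,1010\}$; that is, this set of length-4 factors equals one of $F$, $\overline{F}$, $F^R$, $\overline{F^R}$ where $F=\{0110,1001,0011,1100,0010,0100,1101,1010\}$.
   Context: For a finite word of length $\ell$ with smallest period $p$, its exponent is $\ell/p$; a $(5/2)^+$-power is a word of exponent $>5/2$; a word avoids $(5/2)^+$-powers if none of its factors is a $(5/2)^+$-power. For a binary word $w$, $\overline{w}$ is its complement (exchange $0\leftrightarrow1$) and $w^R$ its reversal, extended to sets elementwise. -}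

module Defs where

open import Data.Bool using (Bool; true; false; not)
open import Data.Nat using (ℕ; zero; suc; _+_; _*_; _≤_; _<_)
open import Data.Fin using (Fin; toℕ)
open import Data.Vec using (Vec; []; _∷_; tabulate; lookup; reverse)
import Data.Vec as Vec
open import Data.List using (List; []; _∷_; length; map)
open import Data.List.Relation.Unary.All using (All)
open import Data.List.Relation.Unary.Unique.Propositional using (Unique)
open import Data.List.Membership.Propositional using (_∈_)
open import Data.Product using (Σ; ∃; _×_)
open import Relation.Binary.PropositionalEquality using (_≡_)
open import Relation.Nullary using (¬_)

-- Binary letters: 0 = false, 1 = true.
-- An infinite binary word.
InfWord : Set
InfWord = ℕ → Bool

factorAt : InfWord → ℕ → (n : ℕ) → Vec Bool n
factorAt w i n = tabulate (λ j → w (i + toℕ j))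

Factor : InfWord → {n : ℕ} → Vec Bool n → Set
Factor w {n} u = ∃ λ i → factorAt w i n ≡ u

ComplexityAtMost2n : InfWord → Set
ComplexityAtMost2n w =
  (n : ℕ) → 1 ≤ n → (us : List (Vec Bool n)) →
  Unique us → All (Factor w) us → length us ≤ 2 * n

IsPeriod : {ℓ : ℕ} → Vec Bool ℓ → ℕ → Set
IsPeriod {ℓ} u p =
  1 ≤ p × p ≤ ℓ ×
  ((i j : Fin ℓ) → toℕ j ≡ toℕ i + p → lookup u i ≡ lookup u j)

SmallestPeriod : {ℓ : ℕ} → Vec Bool ℓ → ℕ → Set
SmallestPeriod u p = IsPeriod u p × ((q : ℕ) → IsPeriod u q → p ≤ q)

-- u is a (5/2)^+-power: exponent ℓ/p > 5/2 with p the smallest period,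
-- i.e. 5p < 2ℓ.
Is52PlusPower : {ℓ : ℕ} → Vec Bool ℓ → Set
Is52PlusPower {ℓ} u = ∃ λ p → SmallestPeriod u p × 5 * p < 2 * ℓ

Avoids52Plus : InfWord → Set
Avoids52Plus w = (i ℓ : ℕ) → ¬ Is52PlusPower (factorAt w i ℓ)

w4 : Bool → Bool → Bool → Bool → Vec Bool 4
w4 a b c d = a ∷ b ∷ c ∷ d ∷ []

private
  O I : Bool
  O = false
  I = true

F : List (Vec Bool 4)
F = w4 O I I O ∷ w4 I O O I ∷ w4 O O I I ∷ w4 I I O O ∷
    w4 O O I O ∷ w4 O I O O ∷ w4 I I O I ∷ w4 I O I O ∷ []

complement : List (Vec Bool 4) → List (Vec Bool 4)
complement = map (Vec.map not)

reversal : List (Vec Bool 4) → List (Vec Bool 4)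
reversal = map reverse

Len4FactorsEqual : InfWord → List (Vec Bool 4) → Set
Len4FactorsEqual w S = (u : Vec Bool 4) → (Factor w u → u ∈ S) × (u ∈ S → Factor w u)

{-# OPTIONS --safe #-}
module Submission where

open import Defs
open import Data.Bool using (Bool; true; false; T; if_then_else_; _∧_; _∨_)
open import Data.Bool.ListAction using (all; any)
open import Data.Bool.Properties using (T-∧; T-≡) renaming (_≟_ to _≟ᵇ_)
open import Data.Empty using (⊥-elim)
open import Data.Fin using (toℕ)
open import Data.Fin.Properties using (toℕ<n; all?)
open import Data.List using (List; []; _∷_; length; upTo)
open import Data.List.Membership.Propositional using (_∈_)
open import Data.List.Relation.Binary.Subset.Propositional using (_⊆_)
open import Data.List.Relation.Unary.All as All using (All; []; _∷_)
open import Data.List.Relation.Unary.All.Properties using (¬Any⇒All¬; all⁺)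
open import Data.List.Relation.Unary.AllPairs using ([]; _∷_)
open import Data.List.Relation.Unary.Any using (Any; here; there; any?; satisfied)
open import Data.List.Relation.Unary.Any.Properties using (any⁻)
open import Data.List.Relation.Unary.Unique.Propositional using (Unique)
open import Data.Nat
open import Data.Nat.DivMod using (_/_; _%_; m≡m%n+[m/n]*n; m%n<n)
open import Data.Nat.Properties
open import Data.Product using (∃; ∃₂; _×_; _,_; proj₁; proj₂)
open import Data.Sum using (_⊎_; inj₁; inj₂)
open import Data.Vec using (Vec; lookup; tabulate)
open import Data.Vec.Properties using (lookup∘tabulate; tabulate-cong; ≡-dec)
open import Function using (Equivalence)
open import Relation.Binary.PropositionalEquality
open import Relation.Nullary using (¬_; Dec; yes; no; does)
open import Relation.Nullary.Decidable using (True; T?; ⌊_⌋; toWitness; _×-dec_; _→-dec_)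
open import Relation.Unary using (Decidable)
import Data.List.Relation.Unary.Unique.DecPropositional as DecUnique

-- The theorem is proved by a finite search through the binary tree of prefixes of w.
-- A prefix is rejected as soon as it ends with a (5/2)⁺-power or has more than 2n
-- distinct factors of length n, for n = 4 or 8.  It is accepted as soon as its factors
-- of length 4 include all of F, F̄, Fᴿ or F̄ᴿ: these sets have 2 · 4 elements, so the
-- complexity bound leaves room for no further factor of length 4 in w.  Every branch
-- of the tree is settled by depth 51, and w runs along one of them.

_∈?_ : ∀ {n} (u : Vec Bool n) (L : List (Vec Bool n)) → Dec (u ∈ L)
u ∈? L = any? (≡-dec _≟ᵇ_ u) L

unique? : ∀ {n} (S : List (Vec Bool n)) → Dec (Unique S)
unique? = DecUnique.unique? (≡-dec _≟ᵇ_)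

does-∨ : ∀ {p} {P : Set p} (P? : Dec P) {b} → does P? ∨ b ≡ true → P ⊎ b ≡ true
does-∨ (yes p) _ = inj₁ p
does-∨ (no _)  e = inj₂ e

∧-true : ∀ a {b} → a ∧ b ≡ true → a ≡ true × b ≡ true
∧-true true e = refl , e

module _ {p} {P : ℕ → Set p} (P? : Decidable P) where

  least-witness : ∀ n → (∃ λ m → m < n × P m) → ∃ λ q → P q × (∀ r → P r → q ≤ r)
  least-witness (suc n) (m , m<1+n , pm) with anyUpTo? P? n
  ... | yes below = least-witness n below
  ... | no none   = m , pm , λ r pr → ≮⇒≥ λ r<m → none (r , <-≤-trans r<m (s≤s⁻¹ m<1+n) , pr)

isPeriod? : ∀ {ℓ} (u : Vec Bool ℓ) → Decidable (IsPeriod u)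
isPeriod? {ℓ} u p = 1 ≤? p ×-dec p ≤? ℓ ×-dec
  all? λ i → all? λ j → toℕ j ≟ toℕ i + p →-dec lookup u i ≟ᵇ lookup u j

period⇒Is52PlusPower : ∀ {ℓ} {u : Vec Bool ℓ} {p} → IsPeriod u p → 5 * p < 2 * ℓ → Is52PlusPower u
period⇒Is52PlusPower {u = u} {p} per 5p<2ℓ
  with least-witness (isPeriod? u) (suc p) (p , ≤-refl , per)
... | q , perq , minimal = q , (perq , minimal) , ≤-<-trans (*-monoʳ-≤ 5 (minimal p per)) 5p<2ℓ

m<n*[1+m/n] : ∀ m n .{{_ : NonZero n}} → m < n * suc (m / n)
m<n*[1+m/n] m n = begin-strict
  m                  ≡⟨ m≡m%n+[m/n]*n m n ⟩
  m % n + m / n * n  <⟨ +-monoˡ-< (m / n * n) (m%n<n m n) ⟩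
  n + m / n * n      ≡⟨ cong (n +_) (*-comm (m / n) n) ⟩
  n + n * (m / n)    ≡⟨ *-suc n (m / n) ⟨
  n * suc (m / n)    ∎
  where open ≤-Reasoning

5p<2ℓ⇒p≤ℓ : ∀ {p ℓ} → 5 * p < 2 * ℓ → p ≤ ℓ
5p<2ℓ⇒p≤ℓ {p} 5p<2ℓ = *-cancelˡ-≤ 2 (≤-trans (*-monoˡ-≤ p (m≤m+n 2 3)) (<⇒≤ 5p<2ℓ))

Periodic : InfWord → (i m p : ℕ) → Set
Periodic f i m p = ∀ {j} → j < m → f (i + j) ≡ f (i + j + p)

periodicᵇ : InfWord → (i m p : ℕ) → Bool
periodicᵇ f i zero    p = true
periodicᵇ f i (suc m) p = does (f (i + m) ≟ᵇ f (i + m + p)) ∧ periodicᵇ f i m p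

periodicᵇ-sound : ∀ f i m p → T (periodicᵇ f i m p) → Periodic f i m p
periodicᵇ-sound f i (suc m) p t {j} j<1+m
  with f (i + m) ≟ᵇ f (i + m + p) | m≤n⇒m<n∨m≡n (s≤s⁻¹ j<1+m)
periodicᵇ-sound f i (suc m) p () _ | no _ | _
... | yes _        | inj₁ j<m  = periodicᵇ-sound f i m p t j<m
... | yes periodic | inj₂ refl = periodic

periodic⇒IsPeriod : ∀ {f i ℓ p} → 1 ≤ p → p ≤ ℓ → Periodic f i (ℓ ∸ p) p → IsPeriod (factorAt f i ℓ) p
periodic⇒IsPeriod {f} {i} {ℓ} {p} 1≤p p≤ℓ periodic = 1≤p , p≤ℓ , λ a b b≡a+p →
  let a<ℓ∸p = m+n≤o⇒m≤o∸n (suc (toℕ a)) (subst (λ x → suc x ≤ ℓ) b≡a+p (toℕ<n b)) in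
  begin
    lookup (factorAt f i ℓ) a  ≡⟨ lookup∘tabulate _ a ⟩
    f (i + toℕ a)              ≡⟨ periodic a<ℓ∸p ⟩
    f (i + toℕ a + p)          ≡⟨ cong f (trans (+-assoc i (toℕ a) p) (cong (i +_) (sym b≡a+p))) ⟩
    f (i + toℕ b)              ≡⟨ lookup∘tabulate _ b ⟨
    lookup (factorAt f i ℓ) b  ∎
  where open ≡-Reasoning

AgreeBelow : ℕ → InfWord → InfWord → Set
AgreeBelow k f g = ∀ {i} → i < k → f i ≡ g i

factorAt-cong : ∀ {k f g} i {n} → AgreeBelow k f g → i + n ≤ k → factorAt f i n ≡ factorAt g i n
factorAt-cong i agree i+n≤k = tabulate-cong λ j → agree (<-≤-trans (+-monoʳ-< i (toℕ<n j)) i+n≤k)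

suffix-factor : ∀ {k f w} n → AgreeBelow k f w → n ≤ k → Factor w (factorAt f (k ∸ n) n)
suffix-factor {k} n agree n≤k = k ∸ n , sym (factorAt-cong (k ∸ n) agree (≤-reflexive (m∸n+n≡m n≤k)))

_[_]≔_ : InfWord → ℕ → Bool → InfWord
(f [ k ]≔ b) i = if i ≡ᵇ k then b else f i

[]≔-agree : ∀ {k f g b} → AgreeBelow k f g → g k ≡ b → AgreeBelow (suc k) (f [ k ]≔ b) g
[]≔-agree {k} agree gk≡b {i} i<1+k with i ≡ᵇ k in i≡ᵇk
... | true rewrite ≡ᵇ⇒≡ i k (Equivalence.from T-≡ i≡ᵇk) = sym gk≡b
... | false = agree (≤∧≢⇒< (s≤s⁻¹ i<1+k) λ i≡k → subst T i≡ᵇk (≡⇒≡ᵇ i k i≡k))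

DistinctFactors : InfWord → ∀ {n} → List (Vec Bool n) → Set
DistinctFactors w L = Unique L × All (Factor w) L

insert : ∀ {n} → Vec Bool n → List (Vec Bool n) → List (Vec Bool n)
insert u L = if does (u ∈? L) then L else u ∷ L

insert-distinct : ∀ {w n} {u : Vec Bool n} {L} → Factor w u → DistinctFactors w L →
                  DistinctFactors w (insert u L)
insert-distinct {u = u} {L} factor (unique , factors) with u ∈? L
... | yes _  = unique , factors
... | no u∉L = ¬Any⇒All¬ L u∉L ∷ unique , factor ∷ factors

module _ {w : InfWord} (complexity : ComplexityAtMost2n w) {n : ℕ} (1≤n : 1 ≤ n) where

  distinctFactors-bounded : {L : List (Vec Bool n)} → DistinctFactors w L → ¬ (2 * n < length L)
  distinctFactors-bounded (unique , factors) = ≤⇒≯ (complexity n 1≤n _ unique factors)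

  saturated⇒factors : (S : List (Vec Bool n)) → Unique S → length S ≡ 2 * n → All (Factor w) S →
                      (u : Vec Bool n) → (Factor w u → u ∈ S) × (u ∈ S → Factor w u)
  saturated⇒factors S unique |S|≡2n factors u = complete , All.lookup factors
    where
    complete : Factor w u → u ∈ S
    complete factor with u ∈? S
    ... | yes u∈S = u∈S
    ... | no u∉S  = ⊥-elim (<-irrefl |S|≡2n
                      (complexity n 1≤n (u ∷ S) (¬Any⇒All¬ S u∉S ∷ unique) (factor ∷ factors)))

powerLength : ℕ → ℕ
powerLength p = suc (5 * p / 2)

powerSuffix : InfWord → ℕ → ℕ → Bool
powerSuffix f k p = (powerLength p ≤ᵇ k) ∧ periodicᵇ f (k ∸ powerLength p) (powerLength p ∸ p) p

-- Only the shortest power of each period p is tested, which forces p ≤ k / 2: a longer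
-- power ends with such a power, and powers ending earlier were tested on shorter prefixes.
endsWithPower : InfWord → ℕ → Bool
endsWithPower f k = any (λ p → powerSuffix f k (suc p)) (upTo (k / 2))

powerSuffix-sound : ∀ {w f k} p → AgreeBelow k f w → T (powerSuffix f k (suc p)) →
                    Is52PlusPower (factorAt w (k ∸ powerLength (suc p)) (powerLength (suc p)))
powerSuffix-sound {w} {f} {k} p agree t =
  subst Is52PlusPower (factorAt-cong {f = f} {w} (k ∸ ℓ) agree (≤-reflexive (m∸n+n≡m ℓ≤k)))
    (period⇒Is52PlusPower {u = factorAt f (k ∸ ℓ) ℓ}
      (periodic⇒IsPeriod {f} (s≤s z≤n) (5p<2ℓ⇒p≤ℓ 5p<2ℓ) periodic) 5p<2ℓ)
  where
  ℓ = powerLength (suc p)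
  5p<2ℓ : 5 * suc p < 2 * ℓ
  5p<2ℓ = m<n*[1+m/n] (5 * suc p) 2
  tests : T (ℓ ≤ᵇ k) × T (periodicᵇ f (k ∸ ℓ) (ℓ ∸ suc p) (suc p))
  tests = Equivalence.to T-∧ t
  ℓ≤k : ℓ ≤ k
  ℓ≤k = ≤ᵇ⇒≤ ℓ k (proj₁ tests)
  periodic : Periodic f (k ∸ ℓ) (ℓ ∸ suc p) (suc p)
  periodic = periodicᵇ-sound f (k ∸ ℓ) (ℓ ∸ suc p) (suc p) (proj₂ tests)

endsWithPower⇒power : ∀ {w f k} → AgreeBelow k f w → T (endsWithPower f k) →
                      ∃₂ λ i ℓ → Is52PlusPower (factorAt w i ℓ)
endsWithPower⇒power {k = k} agree t with satisfied (any⁻ _ (upTo (k / 2)) t)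
... | p , t′ = k ∸ powerLength (suc p) , powerLength (suc p) , powerSuffix-sound p agree t′

recordSuffix : ∀ {n} → InfWord → ℕ → List (Vec Bool n) → List (Vec Bool n)
recordSuffix {n} f k L with n ≤? k
... | yes _ = insert (factorAt f (k ∸ n) n) L
... | no _  = L

recordSuffix-distinct : ∀ {w f k n} {L : List (Vec Bool n)} → AgreeBelow k f w →
                        DistinctFactors w L → DistinctFactors w (recordSuffix f k L)
recordSuffix-distinct {w} {f} {k} {n} agree distinct with n ≤? k
... | yes n≤k = insert-distinct {w} (suffix-factor {k} {f} n agree n≤k) distinct
... | no _    = distinct

record Prefix : Set where
  constructor prefix
  field
    letters  : InfWord
    size     : ℕ
    factors₄ : List (Vec Bool 4)
    factors₈ : List (Vec Bool 8)
open Prefix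

record PrefixOf (w : InfWord) (s : Prefix) : Set where
  field
    agree     : AgreeBelow (size s) (letters s) w
    distinct₄ : DistinctFactors w (factors₄ s)
    distinct₈ : DistinctFactors w (factors₈ s)
open PrefixOf

empty : Prefix
empty = prefix (λ _ → false) 0 [] []

empty-prefixOf : ∀ {w} → PrefixOf w empty
empty-prefixOf = record { agree = λ (); distinct₄ = [] , []; distinct₈ = [] , [] }

_∷ʳ_ : Prefix → Bool → Prefix
prefix f k L₄ L₈ ∷ʳ b = prefix f′ (suc k) (recordSuffix f′ (suc k) L₄) (recordSuffix f′ (suc k) L₈)
  where f′ = f [ k ]≔ b

∷ʳ-prefixOf : ∀ {w s b} → PrefixOf w s → w (size s) ≡ b → PrefixOf w (s ∷ʳ b)
∷ʳ-prefixOf valid wk≡b = record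
  { agree     = agree′
  ; distinct₄ = recordSuffix-distinct agree′ (distinct₄ valid)
  ; distinct₈ = recordSuffix-distinct agree′ (distinct₈ valid)
  }
  where agree′ = []≔-agree (agree valid) wk≡b

_⊆ᵇ_ : ∀ {n} → List (Vec Bool n) → List (Vec Bool n) → Bool
S ⊆ᵇ L = all (λ u → ⌊ u ∈? L ⌋) S

⊆ᵇ-sound : ∀ {n} (S L : List (Vec Bool n)) → T (S ⊆ᵇ L) → S ⊆ L
⊆ᵇ-sound S L t {u} u∈S = toWitness {a? = u ∈? L} (All.lookup (all⁺ _ S t) u∈S)

variants : List (List (Vec Bool 4))
variants = F ∷ complement F ∷ reversal F ∷ complement (reversal F) ∷ []

mutual
  closed : ℕ → Prefix → Bool
  closed d s = endsWithPower (letters s) (size s)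
             ∨ does (2 * 4 <? length (factors₄ s))
             ∨ does (2 * 8 <? length (factors₈ s))
             ∨ any (_⊆ᵇ factors₄ s) variants
             ∨ extensionsClosed d s

  extensionsClosed : ℕ → Prefix → Bool
  extensionsClosed zero    s = false
  extensionsClosed (suc d) s = closed d (s ∷ʳ false) ∧ closed d (s ∷ʳ true)

empty-closed : closed 51 empty ≡ true
empty-closed = refl

Len4FactorsUpToSymmetry : InfWord → Set
Len4FactorsUpToSymmetry w =
  Len4FactorsEqual w F ⊎ Len4FactorsEqual w (complement F) ⊎
  Len4FactorsEqual w (reversal F) ⊎ Len4FactorsEqual w (complement (reversal F))

module _ {w : InfWord} (complexity : ComplexityAtMost2n w) (avoids : Avoids52Plus w) where

  variant-sound : ∀ {L} → DistinctFactors w L → Any (λ S → T (S ⊆ᵇ L)) variants →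
                  Len4FactorsUpToSymmetry w
  variant-sound {L} (_ , factors) = λ where
      (here S⊆L)                         → inj₁ (saturated F S⊆L)
      (there (here S⊆L))                 → inj₂ (inj₁ (saturated (complement F) S⊆L))
      (there (there (here S⊆L)))         → inj₂ (inj₂ (inj₁ (saturated (reversal F) S⊆L)))
      (there (there (there (here S⊆L)))) → inj₂ (inj₂ (inj₂ (saturated (complement (reversal F)) S⊆L)))
    where
    saturated : (S : List (Vec Bool 4)) {unique : True (unique? S)} {|S|≡8 : True (length S ≟ 8)} →
                T (S ⊆ᵇ L) → Len4FactorsEqual w S
    saturated S {unique} {|S|≡8} S⊆L =
      saturated⇒factors {w} complexity (s≤s z≤n) S (toWitness unique) (toWitness |S|≡8)
        (All.tabulate λ u∈S → All.lookup factors (⊆ᵇ-sound S L S⊆L u∈S))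

  mutual
    closed-sound : ∀ d s → PrefixOf w s → closed d s ≡ true → Len4FactorsUpToSymmetry w
    closed-sound d s valid c₀ with does-∨ (T? (endsWithPower (letters s) (size s))) c₀
    ... | inj₁ power =
      let i , ℓ , isPower = endsWithPower⇒power (agree valid) power in ⊥-elim (avoids i ℓ isPower)
    ... | inj₂ c₁ with does-∨ (2 * 4 <? length (factors₄ s)) c₁
    ... | inj₁ many = ⊥-elim (distinctFactors-bounded {w} complexity (s≤s z≤n) (distinct₄ valid) many)
    ... | inj₂ c₂ with does-∨ (2 * 8 <? length (factors₈ s)) c₂
    ... | inj₁ many = ⊥-elim (distinctFactors-bounded {w} complexity (s≤s z≤n) (distinct₈ valid) many)
    ... | inj₂ c₃ with does-∨ (T? (any (_⊆ᵇ factors₄ s) variants)) c₃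
    ... | inj₁ variant = variant-sound (distinct₄ valid) (any⁻ _ variants variant)
    ... | inj₂ c₄ = extensionsClosed-sound d s valid c₄

    extensionsClosed-sound : ∀ d s → PrefixOf w s → extensionsClosed d s ≡ true →
                             Len4FactorsUpToSymmetry w
    extensionsClosed-sound (suc d) s valid c with ∧-true (closed d (s ∷ʳ false)) c | w (size s) in wk
    ... | c₀ , _ | false = closed-sound d (s ∷ʳ false) (∷ʳ-prefixOf valid wk) c₀
    ... | _ , c₁ | true  = closed-sound d (s ∷ʳ true) (∷ʳ-prefixOf valid wk) c₁

theorem4 : (w : InfWord) → ComplexityAtMost2n w → Avoids52Plus w →
    Len4FactorsEqual w F ⊎ Len4FactorsEqual w (complement F) ⊎
    Len4FactorsEqual w (reversal F) ⊎ Len4FactorsEqual w (complement (reversal F))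
theorem4 w complexity avoids =
  closed-sound {w} complexity avoids 51 empty empty-prefixOf empty-closed
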